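{- For a compliant graph $\mathbb{G},$ $\gamma_t(\mathbb{G})\leq \frac{TDI}{n}\leq \Gamma_t(\mathbb{G}).$
   Context: $n$ is the number of vertices of $\mathbb{G}$. A total dominating set (TDS) is a vertex set $S$ such that every vertex is adjacent to a vertex of $S$; a minimal TDS (MTDS) has no proper subset that is a TDS. $\gamma_t$ is the minimum TDS cardinality, $\Gamma_t$ the maximum MTDS cardinality. A graph is compliant if every vertex lies in some MTDS. $d_{td}(a)=\min\{|S| : S \text{ an MTDS containing } a\}$ and $TDI(\mathbb{G})=\sum_{a\in V(\mathbb{G})} d_{td}(a)$. -}

module Defs where

open import Data.Nat using (ℕ; _≤_)
open import Data.Bool using (Bool; true; false)
open import Data.Fin using (Fin)
open import Data.Fin.Subset using (Subset; _∈_; _⊂_; ∣_∣)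
open import Data.Product using (Σ; ∃; _×_)
open import Relation.Binary.PropositionalEquality using (_≡_)
open import Relation.Nullary using (¬_)

record Graph (n : ℕ) : Set where
  field
    adj   : Fin n → Fin n → Bool
    sym   : ∀ a b → adj a b ≡ adj b a
    irrefl : ∀ a → adj a a ≡ false

open Graph public

Adj : ∀ {n} → Graph n → Fin n → Fin n → Set
Adj G a b = adj G a b ≡ true

IsTDS : ∀ {n} → Graph n → Subset n → Set
IsTDS {n} G S = ∀ (v : Fin n) → ∃ λ u → u ∈ S × Adj G v u

IsMTDS : ∀ {n} → Graph n → Subset n → Set
IsMTDS G S = IsTDS G S × (∀ T → T ⊂ S → ¬ IsTDS G T)

Compliant : ∀ {n} → Graph n → Set
Compliant {n} G = ∀ (a : Fin n) → ∃ λ S → IsMTDS G S × a ∈ S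

IsGammaT : ∀ {n} → Graph n → ℕ → Set
IsGammaT G k = (∃ λ S → IsTDS G S × ∣ S ∣ ≡ k) × (∀ S → IsTDS G S → k ≤ ∣ S ∣)

IsUpperGammaT : ∀ {n} → Graph n → ℕ → Set
IsUpperGammaT G k = (∃ λ S → IsMTDS G S × ∣ S ∣ ≡ k) × (∀ S → IsMTDS G S → ∣ S ∣ ≤ k)

IsDtd : ∀ {n} → Graph n → Fin n → ℕ → Set
IsDtd G a k = (∃ λ S → IsMTDS G S × a ∈ S × ∣ S ∣ ≡ k)
            × (∀ S → IsMTDS G S → a ∈ S → k ≤ ∣ S ∣)

{-# OPTIONS --safe #-}
module Submission where

open import Defs
open import Data.Nat using (ℕ; _≤_; _*_; zero; suc; z≤n)
open import Data.Nat.Properties using (*-comm; +-mono-≤)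
open import Data.Fin using (Fin)
open import Data.Vec using (sum; tabulate)
open import Data.Product using (_×_; _,_; proj₁; proj₂)
open import Relation.Binary.PropositionalEquality using (subst)

n*c≤sum-tabulate : ∀ n {c : ℕ} (f : Fin n → ℕ) → (∀ i → c ≤ f i) →
                   n * c ≤ sum (tabulate f)
n*c≤sum-tabulate zero    f c≤f = z≤n
n*c≤sum-tabulate (suc n) f c≤f =
  +-mono-≤ (c≤f Fin.zero) (n*c≤sum-tabulate n (λ i → f (Fin.suc i)) (λ i → c≤f (Fin.suc i)))

sum-tabulate≤n*c : ∀ n {c : ℕ} (f : Fin n → ℕ) → (∀ i → f i ≤ c) →
                   sum (tabulate f) ≤ n * c
sum-tabulate≤n*c zero    f f≤c = z≤n
sum-tabulate≤n*c (suc n) f f≤c =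
  +-mono-≤ (f≤c Fin.zero) (sum-tabulate≤n*c n (λ i → f (Fin.suc i)) (λ i → f≤c (Fin.suc i)))

module _ {n : ℕ} (G : Graph n) {a : Fin n} {k : ℕ} (dtd : IsDtd G a k) where

  γt≤dtd : ∀ {g} → IsGammaT G g → g ≤ k
  γt≤dtd (_ , minimum) with proj₁ dtd
  ... | S , (tds , _) , _ , ∣S∣≡k = subst (_ ≤_) ∣S∣≡k (minimum S tds)

  dtd≤Γt : ∀ {Γ} → IsUpperGammaT G Γ → k ≤ Γ
  dtd≤Γt (_ , maximum) with proj₁ dtd
  ... | S , mtds , _ , ∣S∣≡k = subst (_≤ _) ∣S∣≡k (maximum S mtds)

proposition6 : ∀ {n : ℕ} (G : Graph n) → Compliant G →
    (d : Fin n → ℕ) → (∀ a → IsDtd G a (d a)) →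
    (g Γ : ℕ) → IsGammaT G g → IsUpperGammaT G Γ →
    (g * n ≤ sum (tabulate d)) × (sum (tabulate d) ≤ Γ * n)
proposition6 {n} G _ d dtd g Γ γt Γt =
  subst (_≤ sum (tabulate d)) (*-comm n g)
        (n*c≤sum-tabulate n d (λ a → γt≤dtd G (dtd a) γt)) ,
  subst (sum (tabulate d) ≤_) (*-comm n Γ)
        (sum-tabulate≤n*c n d (λ a → dtd≤Γt G (dtd a) Γt))
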